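{- Let $G$ be a graph, let $(A,B)$ be a bipartition of $V(G)$ such that every vertex of $A$ is adjacent to every vertex of $B$, and let $\varphi$ be a linear coloring of $G$. Then in at least one of $A$ and $B$, the coloring $\varphi$ assigns pairwise different colors to all the vertices.
   Context: All graphs are finite and simple. A linear coloring of $G$ is an assignment of integers (colors) to its vertices such that every path of $G$ (as a subgraph) contains a vertex whose color appears exactly once on that path. -}

module Defs where

open import Data.Nat using (ℕ)
open import Data.Integer using (ℤ)
import Data.Integer as ℤ
open import Data.Fin using (Fin)
open import Data.Bool using (Bool; true; false)
open import Data.List using (List; []; length; filter)
open import Data.List.Membership.Propositional using (_∈_)
open import Data.List.Relation.Unary.Unique.Propositional using (Unique)
open import Data.List.Relation.Unary.Linked using (Linked)
open import Data.Product using (Σ; _×_; ∃-syntax)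
open import Relation.Binary.PropositionalEquality using (_≡_; _≢_)
open import Relation.Nullary using (¬_)

record Graph : Set where
  field
    n      : ℕ
    adj    : Fin n → Fin n → Bool
    sym    : ∀ u v → adj u v ≡ adj v u
    irrefl : ∀ v → adj v v ≡ false

open Graph public

record IsPath (G : Graph) (ps : List (Fin (n G))) : Set where
  field
    nonempty : ps ≢ []
    distinct : Unique ps
    linked   : Linked (λ u v → adj G u v ≡ true) ps

count : ∀ {m} → (Fin m → ℤ) → ℤ → List (Fin m) → ℕ
count φ c ps = length (filter (λ v → φ v ℤ.≟ c) ps)

HasUniqueColour : ∀ {m} → (Fin m → ℤ) → List (Fin m) → Set
HasUniqueColour φ ps = ∃[ v ] (v ∈ ps × count φ (φ v) ps ≡ 1)

IsLinearColouring : (G : Graph) → (Fin (n G) → ℤ) → Set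
IsLinearColouring G φ = ∀ ps → IsPath G ps → HasUniqueColour φ ps

InjectiveOn : ∀ {m} → (Fin m → Set) → (Fin m → ℤ) → Set
InjectiveOn P φ = ∀ u v → P u → P v → φ u ≡ φ v → u ≡ v

{-# OPTIONS --safe #-}
-- If both A and B contained two distinct vertices of equal colour, say
-- a₁, a₂ ∈ A and b₁, b₂ ∈ B, then a₁ b₁ a₂ b₂ would be a path of G whose
-- colour sequence α β α β is a word repeated twice; on such a path every
-- colour occurs an even number of times, so none occurs exactly once.
module Submission where

open import Defs hiding (sym)
open import Data.Integer using (ℤ)
import Data.Integer as ℤ
open import Data.Fin using (Fin)
import Data.Fin as Fin
open import Data.Fin.Properties using (any?)
open import Data.Bool using (Bool; true; false)
import Data.Bool as Bool
open import Data.Nat using (ℕ; zero; suc; _+_)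
open import Data.Nat.Properties using (suc-injective; m+1+n≢0)
open import Data.List using (List; []; _∷_; _++_; length; filter; map)
open import Data.List.Properties using (filter-++; length-++)
open import Data.List.Relation.Unary.All using ([]; _∷_)
open import Data.List.Relation.Unary.AllPairs using ([]; _∷_)
open import Data.List.Relation.Unary.Linked using ([-]; _∷_)
open import Data.Product using (_×_; _,_; ∃-syntax)
open import Data.Sum using (_⊎_; inj₁; inj₂)
open import Data.Empty using (⊥-elim)
open import Relation.Nullary using (¬_; yes; no)
open import Relation.Nullary.Decidable using (_×-dec_; ¬?)
open import Relation.Unary using (Decidable)
open import Relation.Binary.PropositionalEquality
  using (_≡_; _≢_; ≢-sym; refl; sym; trans; cong; cong₂; module ≡-Reasoning)

n+n≢1 : ∀ k → k + k ≢ 1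
n+n≢1 zero    ()
n+n≢1 (suc k) eq = m+1+n≢0 k (suc-injective eq)

module _ {m : ℕ} (φ : Fin m → ℤ) (c : ℤ) where

  count-++ : ∀ xs ys → count φ c (xs ++ ys) ≡ count φ c xs + count φ c ys
  count-++ xs ys = begin
    length (filter (λ v → φ v ℤ.≟ c) (xs ++ ys))
      ≡⟨ cong length (filter-++ (λ v → φ v ℤ.≟ c) xs ys) ⟩
    length (filter (λ v → φ v ℤ.≟ c) xs ++ filter (λ v → φ v ℤ.≟ c) ys)
      ≡⟨ length-++ (filter (λ v → φ v ℤ.≟ c) xs) ⟩
    count φ c xs + count φ c ys ∎
    where open ≡-Reasoning

  count-map : ∀ xs → count φ c xs ≡ length (filter (ℤ._≟ c) (map φ xs))
  count-map []       = refl
  count-map (x ∷ xs) with φ x ℤ.≟ c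
  ... | yes _ = cong suc (count-map xs)
  ... | no  _ = count-map xs

  count-cong-map : ∀ {xs ys} → map φ xs ≡ map φ ys → count φ c xs ≡ count φ c ys
  count-cong-map {xs} {ys} eq = begin
    count φ c xs                              ≡⟨ count-map xs ⟩
    length (filter (ℤ._≟ c) (map φ xs))       ≡⟨ cong (λ cs → length (filter (ℤ._≟ c) cs)) eq ⟩
    length (filter (ℤ._≟ c) (map φ ys))       ≡⟨ sym (count-map ys) ⟩
    count φ c ys                              ∎
    where open ≡-Reasoning

map-≡⇒¬HasUniqueColour-++ : ∀ {m} (φ : Fin m → ℤ) {xs ys : List (Fin m)}
  → map φ xs ≡ map φ ys → ¬ HasUniqueColour φ (xs ++ ys)
map-≡⇒¬HasUniqueColour-++ φ {xs} {ys} eq (v , _ , once) = n+n≢1 (count φ (φ v) xs) (begin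
  count φ (φ v) xs + count φ (φ v) xs  ≡⟨ cong (count φ (φ v) xs +_) (count-cong-map φ (φ v) eq) ⟩
  count φ (φ v) xs + count φ (φ v) ys  ≡⟨ sym (count-++ φ (φ v) xs ys) ⟩
  count φ (φ v) (xs ++ ys)             ≡⟨ once ⟩
  1                                    ∎)
  where open ≡-Reasoning

Collision : ∀ {m} → (Fin m → Set) → (Fin m → ℤ) → Set
Collision P φ = ∃[ u ] ∃[ v ] (P u × P v × φ u ≡ φ v × u ≢ v)

injectiveOn⊎collision : ∀ {m} {P : Fin m → Set} → Decidable P → (φ : Fin m → ℤ)
  → InjectiveOn P φ ⊎ Collision P φ
injectiveOn⊎collision P? φ with any? (λ u → any? (λ v →
  P? u ×-dec P? v ×-dec (φ u ℤ.≟ φ v) ×-dec ¬? (u Fin.≟ v)))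
... | yes collision = inj₂ collision
... | no ¬collision = inj₁ injective
  where
  injective : InjectiveOn _ φ
  injective u v Pu Pv φu≡φv with u Fin.≟ v
  ... | yes u≡v = u≡v
  ... | no  u≢v = ⊥-elim (¬collision (u , v , Pu , Pv , φu≡φv , u≢v))

sides-differ : ∀ {V : Set} {side : V → Bool} {a b}
  → side a ≡ true → side b ≡ false → a ≢ b
sides-differ sa sb refl with trans (sym sa) sb
... | ()

module _ (G : Graph) (side : Fin (n G) → Bool)
  (complete : ∀ a b → side a ≡ true → side b ≡ false → adj G a b ≡ true) where

  alternating-isPath : ∀ {a₁ a₂ b₁ b₂}
    → side a₁ ≡ true → side a₂ ≡ true → side b₁ ≡ false → side b₂ ≡ false
    → a₁ ≢ a₂ → b₁ ≢ b₂ → IsPath G (a₁ ∷ b₁ ∷ a₂ ∷ b₂ ∷ [])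
  alternating-isPath {a₁} {a₂} {b₁} {b₂} sa₁ sa₂ sb₁ sb₂ a₁≢a₂ b₁≢b₂ = record
    { nonempty = λ ()
    ; distinct = (sides-differ sa₁ sb₁ ∷ a₁≢a₂ ∷ sides-differ sa₁ sb₂ ∷ [])
               ∷ (≢-sym (sides-differ sa₂ sb₁) ∷ b₁≢b₂ ∷ [])
               ∷ (sides-differ sa₂ sb₂ ∷ [])
               ∷ [] ∷ []
    ; linked   = complete a₁ b₁ sa₁ sb₁
               ∷ trans (Graph.sym G b₁ a₂) (complete a₂ b₁ sa₂ sb₁)
               ∷ complete a₂ b₂ sa₂ sb₂
               ∷ [-]
    }

lemma4p1 : (G : Graph) (side : Fin (n G) → Bool) (φ : Fin (n G) → ℤ)
    → (∀ a b → side a ≡ true → side b ≡ false → adj G a b ≡ true)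
    → IsLinearColouring G φ
    → InjectiveOn (λ v → side v ≡ true) φ ⊎ InjectiveOn (λ v → side v ≡ false) φ
lemma4p1 G side φ complete linear
  with injectiveOn⊎collision (λ v → side v Bool.≟ true) φ
     | injectiveOn⊎collision (λ v → side v Bool.≟ false) φ
... | inj₁ injectiveA | _               = inj₁ injectiveA
... | inj₂ _          | inj₁ injectiveB = inj₂ injectiveB
... | inj₂ (a₁ , a₂ , sa₁ , sa₂ , φa₁≡φa₂ , a₁≢a₂)
    | inj₂ (b₁ , b₂ , sb₁ , sb₂ , φb₁≡φb₂ , b₁≢b₂) =
  ⊥-elim (map-≡⇒¬HasUniqueColour-++ φ {a₁ ∷ b₁ ∷ []} {a₂ ∷ b₂ ∷ []}
            (cong₂ (λ α β → α ∷ β ∷ []) φa₁≡φa₂ φb₁≡φb₂)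
            (linear _ (alternating-isPath G side complete sa₁ sa₂ sb₁ sb₂ a₁≢a₂ b₁≢b₂)))
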